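{- Let $f\colon\{0,1\}^n\to\{0,1\}$ be symmetric, i.e. $f(x)$ depends only on the number of ones in $x$. Then there exists a symmetric distribution $\mu$ on $f^{ -1}(1)$ (i.e. $\mu(x)$ depends only on the number of ones in $x$) such that $D(f)=D_\mu(f)$.
   Context: A CNF formula is an AND of clauses (ORs of literals); its size $|\phi|$ is its number of clauses. $\mathrm{CNF}_f$ is the set of all CNF formulas $\phi$ on $n$ variables with $\phi^{ -1}(1)\subseteq f^{ -1}(1)$. For a distribution $\mu$ on $f^{ -1}(1)$, $D_\mu(f):=\max_{\phi\in\mathrm{CNF}_f}\Pr_{x\sim\mu}[\phi(x)=1]/|\phi|$ (with $0/0=0$), and $D(f):=\min_\mu D_\mu(f)$ over all distributions $\mu$ on $f^{ -1}(1)$.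
   Formalization: Distributions on $f^{ -1}(1)$, both the symmetric μ and those over which D(f) is minimized, take rational values rather than real values in [0,1]. -}

module Defs where

open import Data.Bool using (Bool; true; false; _∧_; _∨_; not; if_then_else_)
open import Data.Nat using (ℕ; zero; suc)
open import Data.Integer using (+_)
open import Data.Rational using (ℚ; 0ℚ; 1ℚ; _+_; _*_; _/_; _≤_)
open import Data.Vec using (Vec; []; _∷_)
open import Data.List using (List; []; _∷_; map; _++_; foldr; length)
open import Data.Product using (_×_; _,_; Σ; ∃)
open import Relation.Binary.PropositionalEquality using (_≡_)

Point : ℕ → Set
Point n = Vec Bool n

ones : ∀ {n} → Point n → ℕ
ones [] = zero
ones (true ∷ xs) = suc (ones xs)
ones (false ∷ xs) = ones xs

allPoints : (n : ℕ) → List (Point n)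
allPoints zero = [] ∷ []
allPoints (suc n) = map (true ∷_) (allPoints n) ++ map (false ∷_) (allPoints n)

SymmetricFn : ∀ {n} → (Point n → Bool) → Set
SymmetricFn {n} f = ∀ (x y : Point n) → ones x ≡ ones y → f x ≡ f y

-- A clause on n variables: for each variable i, a pair (p , q) where
-- p = true means the literal x_i occurs and q = true means ¬x_i occurs.
Clause : ℕ → Set
Clause n = Vec (Bool × Bool) n

evalClause : ∀ {n} → Clause n → Point n → Bool
evalClause [] [] = false
evalClause ((p , q) ∷ c) (b ∷ x) = ((p ∧ b) ∨ (q ∧ not b)) ∨ evalClause c x

CNF : ℕ → Set
CNF n = List (Clause n)

evalCNF : ∀ {n} → CNF n → Point n → Bool
evalCNF [] x = true
evalCNF (c ∷ φ) x = evalClause c x ∧ evalCNF φ x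

size : ∀ {n} → CNF n → ℕ
size = length

InCNF : ∀ {n} → (Point n → Bool) → CNF n → Set
InCNF {n} f φ = ∀ (x : Point n) → evalCNF φ x ≡ true → f x ≡ true

sumℚ : List ℚ → ℚ
sumℚ = foldr _+_ 0ℚ

record Distribution {n : ℕ} (f : Point n → Bool) : Set where
  field
    mass       : Point n → ℚ
    nonneg     : ∀ x → 0ℚ ≤ mass x
    total      : sumℚ (map mass (allPoints n)) ≡ 1ℚ
    supported  : ∀ x → f x ≡ false → mass x ≡ 0ℚ
open Distribution public

SymmetricDist : ∀ {n} {f : Point n → Bool} → Distribution f → Set
SymmetricDist {n} μ = ∀ (x y : Point n) → ones x ≡ ones y → mass μ x ≡ mass μ y

prob : ∀ {n} {f : Point n → Bool} → Distribution f → CNF n → ℚ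
prob {n} μ φ = sumℚ (map (λ x → if evalCNF φ x then mass μ x else 0ℚ) (allPoints n))

-- Pr_mu[phi = 1] / size phi; for the empty CNF (size 0) the value is 0 (0/0 = 0 convention)
ratio : ∀ {n} {f : Point n → Bool} → Distribution f → CNF n → ℚ
ratio μ φ with size φ
... | zero  = 0ℚ
... | suc k = prob μ φ * (+ 1 / suc k)

IsDμ : ∀ {n} {f : Point n → Bool} → Distribution f → ℚ → Set
IsDμ {n} {f} μ d =
  (Σ (CNF n) λ φ → InCNF f φ × ratio μ φ ≡ d) ×
  (∀ (φ : CNF n) → InCNF f φ → ratio μ φ ≤ d)

{-# OPTIONS --safe #-}
module Submission where

-- Removing repeated clauses keeps the satisfying set of a CNF and shortens it, so D_μ(f) is a maximum
-- over the finitely many duplicate-free CNFs in CNF_f.  Averaging μ over all permutations of the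
-- coordinates gives the distribution that spreads the mass of each level uniformly over it; since
-- permuting the variables maps CNF_f onto itself and preserves sizes, the average does not increase
-- D_μ(f) when f is symmetric.  So D(f) is the minimum of D_μ(f) over symmetric μ, that is, the optimum
-- of a linear program in the level masses and a bound t with one constraint per duplicate-free CNF;
-- Fourier–Motzkin elimination shows that this minimum is attained.

open import Data.Bool using (Bool; true; false; _∧_; _∨_; not; if_then_else_)
import Data.Bool.Properties as Bool
open import Data.Empty using (⊥-elim)
open import Data.Fin as Fin using (Fin; zero; suc; toℕ)
import Data.Fin.Properties as Fin
import Data.Integer as ℤ
import Data.Integer.Properties as ℤ
open import Data.List using (List; []; _∷_; map; _++_; length; cartesianProductWith; filter; deduplicate; allFin)
open import Data.List.Membership.Propositional using (_∈_)
open import Data.List.Membership.Propositional.Properties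
  using (∈-map⁺; ∈-++⁺ˡ; ∈-++⁺ʳ; ∈-allFin; ∈-cartesianProductWith⁺; ∈-cartesianProductWith⁻; ∈-filter⁺; ∈-filter⁻;
         ∈-deduplicate⁺; ∈-deduplicate⁻)
import Data.List.Properties as List
open import Data.List.Relation.Unary.All as All using (All; []; _∷_)
import Data.List.Relation.Unary.All.Properties as All
open import Data.List.Relation.Unary.AllPairs using ([]; _∷_)
open import Data.List.Relation.Unary.Any as Any using (here; there)
open import Data.List.Relation.Unary.Unique.DecPropositional.Properties using (deduplicate-!)
open import Data.List.Relation.Unary.Unique.Propositional using (Unique)
open import Data.Nat as ℕ using (ℕ; zero; suc)
import Data.Nat.Properties as ℕ
open import Data.Product using (_×_; _,_; Σ; ∃; proj₁; proj₂)
import Data.Product.Properties as Product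
open import Data.Rational hiding (truncate)
open import Data.Rational.Properties
open import Data.Rational.Solver using (module +-*-Solver)
import Data.Rational.Unnormalised as ℚᵘ
import Data.Rational.Unnormalised.Properties as ℚᵘ
open import Data.Unit using (⊤; tt)
open import Data.Vec as Vec using (Vec; []; _∷_; [_])
import Data.Vec.Properties as Vec
open import Function using (_∘_; id; _⇔_; mk⇔; Equivalence)
open import Function.Construct.Composition using (_⇔-∘_)
open import Relation.Binary.Bundles using (DecTotalOrder)
open import Relation.Binary.Definitions using (tri<; tri≈; tri>)
open import Relation.Binary.PropositionalEquality hiding ([_])
open import Relation.Nullary using (yes; no; does; Dec)
open import Relation.Nullary.Decidable using (dec-true; dec-false; map′; _→-dec_)
open import Data.List.Extrema (DecTotalOrder.totalOrder ≤-decTotalOrder)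
  using (max; min; xs≤max; max≤v⁺; min≤xs; argmax; argmax-all; f[xs]≤f[argmax])

open import Defs

open +-*-Solver using (solve; _:+_; _:*_; :-_; _:-_; _:=_; con)

private
  variable
    A B : Set
    m n : ℕ

-- Sums over lists

∑ : List A → (A → ℚ) → ℚ
∑ xs g = sumℚ (map g xs)

∑-cong : ∀ (xs : List A) {g h} → (∀ a → g a ≡ h a) → ∑ xs g ≡ ∑ xs h
∑-cong xs g≗h = cong sumℚ (List.map-cong g≗h xs)

∑-++ : ∀ (xs ys : List A) g → ∑ (xs ++ ys) g ≡ ∑ xs g + ∑ ys g
∑-++ []       ys g = sym (+-identityˡ _)
∑-++ (x ∷ xs) ys g = trans (cong (g x +_) (∑-++ xs ys g)) (sym (+-assoc (g x) _ _))

∑-map : ∀ (f : A → B) xs g → ∑ (map f xs) g ≡ ∑ xs (g ∘ f)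
∑-map f xs g = cong sumℚ (sym (List.map-∘ xs))

∑-zero : ∀ (xs : List A) → ∑ xs (λ _ → 0ℚ) ≡ 0ℚ
∑-zero []       = refl
∑-zero (x ∷ xs) = trans (+-identityˡ _) (∑-zero xs)

∑-+ : ∀ (xs : List A) g h → ∑ xs (λ a → g a + h a) ≡ ∑ xs g + ∑ xs h
∑-+ []       g h = sym (+-identityˡ 0ℚ)
∑-+ (x ∷ xs) g h = trans (cong (g x + h x +_) (∑-+ xs g h)) (+-interchange (g x) (h x) _ _)
  where
  +-interchange : ∀ a b c d → (a + b) + (c + d) ≡ (a + c) + (b + d)
  +-interchange = solve 4 (λ a b c d → (a :+ b) :+ (c :+ d) := (a :+ c) :+ (b :+ d)) refl

∑-*ˡ : ∀ (xs : List A) c g → ∑ xs (λ a → c * g a) ≡ c * ∑ xs g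
∑-*ˡ []       c g = sym (*-zeroʳ c)
∑-*ˡ (x ∷ xs) c g = trans (cong (c * g x +_) (∑-*ˡ xs c g)) (sym (*-distribˡ-+ c (g x) _))

∑-*ʳ : ∀ (xs : List A) g c → ∑ xs (λ a → g a * c) ≡ ∑ xs g * c
∑-*ʳ xs g c = trans (∑-cong xs (λ a → *-comm (g a) c)) (trans (∑-*ˡ xs c g) (*-comm c _))

∑-swap : ∀ (xs : List A) (ys : List B) (g : A → B → ℚ) → ∑ xs (λ a → ∑ ys (g a)) ≡ ∑ ys (λ b → ∑ xs (λ a → g a b))
∑-swap []       ys g = sym (∑-zero ys)
∑-swap (x ∷ xs) ys g = trans (cong (∑ ys (g x) +_) (∑-swap xs ys g)) (sym (∑-+ ys (g x) _))

∑-mono-≤ : ∀ (xs : List A) {g h} → (∀ a → g a ≤ h a) → ∑ xs g ≤ ∑ xs h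
∑-mono-≤ []       g≤h = ≤-refl
∑-mono-≤ (x ∷ xs) g≤h = +-mono-≤ (g≤h x) (∑-mono-≤ xs g≤h)

∑-nonNeg : ∀ (xs : List A) {g} → (∀ a → 0ℚ ≤ g a) → 0ℚ ≤ ∑ xs g
∑-nonNeg xs {g} g≥0 = subst (_≤ ∑ xs g) (∑-zero xs) (∑-mono-≤ xs g≥0)

term≤∑ : ∀ {xs : List A} {g x} → (∀ a → 0ℚ ≤ g a) → x ∈ xs → g x ≤ ∑ xs g
term≤∑ {xs = y ∷ xs} {g} g≥0 (here refl) = subst (_≤ ∑ (y ∷ xs) g) (+-identityʳ (g y)) (+-monoʳ-≤ (g y) (∑-nonNeg xs g≥0))
term≤∑ {xs = y ∷ xs} {g} g≥0 (there x∈xs) =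
  ≤-trans (term≤∑ g≥0 x∈xs) (subst (_≤ ∑ (y ∷ xs) g) (+-identityˡ (∑ xs g)) (+-monoˡ-≤ (∑ xs g) (g≥0 y)))

-- Linear inequalities and Fourier–Motzkin elimination

infixl 7 _·_
_·_ : Vec ℚ m → Vec ℚ m → ℚ
[]       · []       = 0ℚ
(a ∷ as) · (x ∷ xs) = a * x + as · xs

·-zipWith-+ : ∀ (a b x : Vec ℚ m) → Vec.zipWith _+_ a b · x ≡ a · x + b · x
·-zipWith-+ []       []       []       = sym (+-identityˡ 0ℚ)
·-zipWith-+ (a ∷ as) (b ∷ bs) (x ∷ xs) = trans (cong ((a + b) * x +_) (·-zipWith-+ as bs xs)) (distrib a b x _ _)
  where
  distrib : ∀ a b x p q → (a + b) * x + (p + q) ≡ (a * x + p) + (b * x + q)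
  distrib = solve 5 (λ a b x p q → (a :+ b) :* x :+ (p :+ q) := (a :* x :+ p) :+ (b :* x :+ q)) refl

·-map-* : ∀ r (a x : Vec ℚ m) → Vec.map (r *_) a · x ≡ r * (a · x)
·-map-* r []       []       = sym (*-zeroʳ r)
·-map-* r (a ∷ as) (x ∷ xs) = trans (cong (r * a * x +_) (·-map-* r as xs)) (distrib r a x _)
  where
  distrib : ∀ r a x p → r * a * x + r * p ≡ r * (a * x + p)
  distrib = solve 4 (λ r a x p → r :* a :* x :+ r :* p := r :* (a :* x :+ p)) refl

zeros : ∀ m → Vec ℚ m
zeros m = Vec.replicate m 0ℚ

·-zeros : ∀ (x : Vec ℚ m) → zeros m · x ≡ 0ℚ
·-zeros []       = refl
·-zeros (x ∷ xs) = trans (cong₂ _+_ (*-zeroˡ x) (·-zeros xs)) (+-identityˡ 0ℚ)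

·-++ : ∀ (a x : Vec ℚ m) (b y : Vec ℚ n) → (a Vec.++ b) · (x Vec.++ y) ≡ a · x + b · y
·-++ []       []       b y = sym (+-identityˡ _)
·-++ (a ∷ as) (x ∷ xs) b y = trans (cong (a * x +_) (·-++ as xs b y)) (sym (+-assoc (a * x) _ _))

unit : Fin m → Vec ℚ m
unit {suc m} zero    = 1ℚ ∷ zeros m
unit {suc m} (suc k) = 0ℚ ∷ unit k

·-unit : ∀ (k : Fin m) x → unit k · x ≡ Vec.lookup x k
·-unit zero    (x ∷ xs) = trans (cong (1ℚ * x +_) (·-zeros xs)) (trans (+-identityʳ _) (*-identityˡ x))
·-unit (suc k) (x ∷ xs) = trans (cong (_+ unit k · xs) (*-zeroˡ x)) (trans (+-identityˡ _) (·-unit k xs))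

·-if : ∀ b (a x : Vec ℚ m) → (if b then a else zeros m) · x ≡ (if b then a · x else 0ℚ)
·-if true  a x = refl
·-if false a x = ·-zeros x

∑ᵥ : List A → (A → Vec ℚ m) → Vec ℚ m
∑ᵥ {m = m} []       F = zeros m
∑ᵥ         (a ∷ as) F = Vec.zipWith _+_ (F a) (∑ᵥ as F)

·-∑ᵥ : ∀ (as : List A) (F : A → Vec ℚ m) x → ∑ᵥ as F · x ≡ ∑ as (λ a → F a · x)
·-∑ᵥ []       F x = ·-zeros x
·-∑ᵥ (a ∷ as) F x = trans (·-zipWith-+ (F a) _ x) (cong (F a · x +_) (·-∑ᵥ as F x))

≤-resp₂-⇔ : ∀ {p p′ q q′} → p ≡ p′ → q ≡ q′ → (p ≤ q) ⇔ (p′ ≤ q′)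
≤-resp₂-⇔ refl refl = mk⇔ id id

≤-translate : ∀ c {p q} → (p ≤ q) ⇔ (p + c ≤ q + c)
≤-translate c {p} {q} = mk⇔ (+-monoˡ-≤ c) (subst₂ _≤_ (cancel p) (cancel q) ∘ +-monoˡ-≤ (- c))
  where
  cancel : ∀ p → p + c + - c ≡ p
  cancel p = solve 2 (λ p c → p :+ c :+ :- c := p) refl p c

≤-scale : ∀ {r p q} → 0ℚ < r → (p ≤ q) ⇔ (r * p ≤ r * q)
≤-scale {r} 0<r = mk⇔ (*-monoˡ-≤-nonNeg r {{nonNegative (<⇒≤ 0<r)}}) (*-cancelˡ-≤-pos r {{positive 0<r}})

reciprocal : ∀ {p} → 0ℚ < p → Σ ℚ λ r → 0ℚ < r × r * p ≡ 1ℚ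
reciprocal {p} 0<p = 1/ p , positive⁻¹ _ {{1/pos⇒pos p}} , *-inverseˡ p
  where instance
    _ = positive 0<p
    _ = pos⇒nonZero p

Row : ℕ → Set
Row m = Vec ℚ m × ℚ

Satisfies : Vec ℚ m → Row m → Set
Satisfies x (a , b) = a · x ≤ b

Solves : List (Row m) → Vec ℚ m → Set
Solves S x = All (Satisfies x) S

Solves-map : ∀ {S : List A} {r : A → Row m} {x} → Solves (map r S) x ⇔ (∀ {a} → a ∈ S → Satisfies x (r a))
Solves-map = mk⇔ (All.lookup ∘ All.map⁻) (All.map⁺ ∘ All.tabulate)

data Bound (m : ℕ) : Set where
  free upper lower : Row m → Bound m

upperValue lowerValue : Vec ℚ m → Row m → ℚ
upperValue x (a , b) = b - a · x
lowerValue x (a , b) = a · x - b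

Holds : ℚ → Vec ℚ m → Bound m → Set
Holds x₀ x (free r)  = Satisfies x r
Holds x₀ x (upper r) = x₀ ≤ upperValue x r
Holds x₀ x (lower r) = lowerValue x r ≤ x₀

≤-moveʳ : ∀ {p q s} → (p + q ≤ s) ⇔ (p ≤ s - q)
≤-moveʳ {p} {q} {s} = ≤-resp₂-⇔ (cancel p q) refl ⇔-∘ ≤-translate (- q)
  where
  cancel : ∀ p q → p + q + - q ≡ p
  cancel = solve 2 (λ p q → p :+ q :+ :- q := p) refl

≤-moveˡ : ∀ {p q s} → (- p + q ≤ s) ⇔ (q - s ≤ p)
≤-moveˡ {p} {q} {s} = ≤-resp₂-⇔ (move p q s) (cancel p s) ⇔-∘ ≤-translate (p - s)
  where
  move : ∀ p q s → - p + q + (p - s) ≡ q - s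
  move = solve 3 (λ p q s → :- p :+ q :+ (p :- s) := q :- s) refl
  cancel : ∀ p s → s + (p - s) ≡ p
  cancel = solve 2 (λ p s → s :+ (p :- s) := p) refl

scale : ℚ → Row m → Row m
scale r (a , b) = Vec.map (r *_) a , r * b

scale-correct : ∀ {r} → 0ℚ < r → ∀ x₀ (x : Vec ℚ m) a₀ a b →
                Satisfies (x₀ ∷ x) (a₀ ∷ a , b) ⇔ (r * a₀ * x₀ + Vec.map (r *_) a · x ≤ r * b)
scale-correct {r = r} 0<r x₀ x a₀ a b =
  ≤-resp₂-⇔ (trans (distribute r a₀ x₀ (a · x)) (cong (r * a₀ * x₀ +_) (sym (·-map-* r a x)))) refl ⇔-∘ ≤-scale 0<r
  where
  distribute : ∀ r a₀ x₀ A → r * (a₀ * x₀ + A) ≡ r * a₀ * x₀ + r * A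
  distribute = solve 4 (λ r a₀ x₀ A → r :* (a₀ :* x₀ :+ A) := r :* a₀ :* x₀ :+ r :* A) refl

-- Scaling by 1/|a₀| makes the coefficient of x₀ equal to ±1, so the row bounds x₀ by an affine function of x.
asBound : Row (suc m) → Bound m
asBound (a₀ ∷ a , b) with <-cmp a₀ 0ℚ
... | tri< a₀<0 _ _ = lower (scale (proj₁ (reciprocal (neg-antimono-< a₀<0))) (a , b))
... | tri≈ _ _ _    = free (a , b)
... | tri> _ _ a₀>0 = upper (scale (proj₁ (reciprocal a₀>0)) (a , b))

asBound-correct : ∀ x₀ (x : Vec ℚ m) r → Satisfies (x₀ ∷ x) r ⇔ Holds x₀ x (asBound r)
asBound-correct x₀ x (a₀ ∷ a , b) with <-cmp a₀ 0ℚ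
... | tri< a₀<0 _ _ =
  let r , 0<r , r*-a₀≡1 = reciprocal (neg-antimono-< a₀<0)
  in ≤-moveˡ ⇔-∘ (≤-resp₂-⇔ (cong (_+ _) (minus-one r a₀ r*-a₀≡1)) refl ⇔-∘ scale-correct 0<r x₀ x a₀ a b)
  where
  minus-one : ∀ r a₀ → r * - a₀ ≡ 1ℚ → r * a₀ * x₀ ≡ - x₀
  minus-one r a₀ r*-a₀≡1 = begin
    r * a₀ * x₀          ≡⟨ solve 3 (λ r a₀ x₀ → r :* a₀ :* x₀ := :- (r :* :- a₀ :* x₀)) refl r a₀ x₀ ⟩
    - (r * - a₀ * x₀)    ≡⟨ cong (λ c → - (c * x₀)) r*-a₀≡1 ⟩
    - (1ℚ * x₀)          ≡⟨ cong -_ (*-identityˡ x₀) ⟩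
    - x₀                 ∎
    where open ≡-Reasoning
... | tri≈ _ refl _ = ≤-resp₂-⇔ (trans (cong (_+ a · x) (*-zeroˡ x₀)) (+-identityˡ (a · x))) refl
... | tri> _ _ a₀>0 =
  let r , 0<r , r*a₀≡1 = reciprocal a₀>0
  in ≤-moveʳ ⇔-∘ (≤-resp₂-⇔ (cong (_+ _) (trans (cong (_* x₀) r*a₀≡1) (*-identityˡ x₀))) refl
                 ⇔-∘ scale-correct 0<r x₀ x a₀ a b)

frees uppers lowers : List (Bound m) → List (Row m)
frees []             = []
frees (free r  ∷ bs) = r ∷ frees bs
frees (upper _ ∷ bs) = frees bs
frees (lower _ ∷ bs) = frees bs
uppers []             = []
uppers (free _  ∷ bs) = uppers bs
uppers (upper r ∷ bs) = r ∷ uppers bs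
uppers (lower _ ∷ bs) = uppers bs
lowers []             = []
lowers (free _  ∷ bs) = lowers bs
lowers (upper _ ∷ bs) = lowers bs
lowers (lower r ∷ bs) = r ∷ lowers bs

module _ (x₀ : ℚ) (x : Vec ℚ m) where

  HoldsAll : List (Bound m) → Set
  HoldsAll bs = All (Holds x₀ x ∘ free) (frees bs) × All (Holds x₀ x ∘ upper) (uppers bs)
              × All (Holds x₀ x ∘ lower) (lowers bs)

  All-Holds⇒ : ∀ bs → All (Holds x₀ x) bs → HoldsAll bs
  All-Holds⇒ []             []       = [] , [] , []
  All-Holds⇒ (free _  ∷ bs) (h ∷ hs) = let f , u , l = All-Holds⇒ bs hs in h ∷ f , u , l
  All-Holds⇒ (upper _ ∷ bs) (h ∷ hs) = let f , u , l = All-Holds⇒ bs hs in f , h ∷ u , l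
  All-Holds⇒ (lower _ ∷ bs) (h ∷ hs) = let f , u , l = All-Holds⇒ bs hs in f , u , h ∷ l

  All-Holds⇐ : ∀ bs → HoldsAll bs → All (Holds x₀ x) bs
  All-Holds⇐ []             _                = []
  All-Holds⇐ (free _  ∷ bs) (h ∷ f , u , l) = h ∷ All-Holds⇐ bs (f , u , l)
  All-Holds⇐ (upper _ ∷ bs) (f , h ∷ u , l) = h ∷ All-Holds⇐ bs (f , u , l)
  All-Holds⇐ (lower _ ∷ bs) (f , u , h ∷ l) = h ∷ All-Holds⇐ bs (f , u , l)

_⊕_ : Row m → Row m → Row m
(a , b) ⊕ (c , d) = Vec.zipWith _+_ a c , b + d

⊕-correct : ∀ (x : Vec ℚ m) u l → Satisfies x (u ⊕ l) ⇔ (lowerValue x l ≤ upperValue x u)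
⊕-correct x (a , b) (c , d) =
  ≤-resp₂-⇔ (lhs (a · x) (c · x) d) (rhs (a · x) b d)
    ⇔-∘ (≤-translate (- d - a · x) ⇔-∘ ≤-resp₂-⇔ (·-zipWith-+ a c x) refl)
  where
  lhs : ∀ A C d → A + C + (- d - A) ≡ C - d
  lhs = solve 3 (λ A C d → A :+ C :+ (:- d :- A) := C :- d) refl
  rhs : ∀ A b d → b + d + (- d - A) ≡ b - A
  rhs = solve 3 (λ A b d → b :+ d :+ (:- d :- A) := b :- A) refl

interpolate : ∀ (ls : List A) (us : List B) (lo : A → ℚ) (hi : B → ℚ) → (∀ {l u} → l ∈ ls → u ∈ us → lo l ≤ hi u) →
              ∃ λ x₀ → All (λ l → lo l ≤ x₀) ls × All (λ u → x₀ ≤ hi u) us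
interpolate ls us lo hi lo≤hi = x₀ , All.map⁻ (xs≤max _ (map lo ls)) , All.tabulate below
  where
  x₀ = max (min 0ℚ (map hi us)) (map lo ls)
  below : ∀ {u} → u ∈ us → x₀ ≤ hi u
  below u∈ = max≤v⁺ (All.lookup (All.map⁻ (min≤xs 0ℚ (map hi us))) u∈) (All.map⁺ (All.tabulate (λ l∈ → lo≤hi l∈ u∈)))

eliminate : List (Row (suc m)) → List (Row m)
eliminate S = frees (map asBound S) ++ cartesianProductWith _⊕_ (uppers (map asBound S)) (lowers (map asBound S))

eliminate-sound : ∀ S x₀ (x : Vec ℚ m) → Solves S (x₀ ∷ x) → Solves (eliminate S) x
eliminate-sound S x₀ x sol = All.++⁺ f (All.tabulate combined)
  where
  bs = map asBound S
  holds = All-Holds⇒ x₀ x bs (All.map⁺ (All.map (λ {r} → Equivalence.to (asBound-correct x₀ x r)) sol))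
  f = proj₁ holds
  combined : ∀ {v} → v ∈ cartesianProductWith _⊕_ (uppers bs) (lowers bs) → Satisfies x v
  combined v∈ with ∈-cartesianProductWith⁻ _⊕_ (uppers bs) (lowers bs) v∈
  ... | u , l , u∈ , l∈ , refl = Equivalence.from (⊕-correct x u l)
    (≤-trans (All.lookup (proj₂ (proj₂ holds)) l∈) (All.lookup (proj₁ (proj₂ holds)) u∈))

eliminate-complete : ∀ S (x : Vec ℚ m) → Solves (eliminate S) x → ∃ λ x₀ → Solves S (x₀ ∷ x)
eliminate-complete S x sol =
  x₀ , All.map (λ {r} → Equivalence.from (asBound-correct x₀ x r)) (All.map⁻ (All-Holds⇐ x₀ x bs (f , u , l)))
  where
  bs = map asBound S
  f = All.++⁻ˡ (frees bs) sol
  gap : ∀ {l u} → l ∈ lowers bs → u ∈ uppers bs → lowerValue x l ≤ upperValue x u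
  gap {l} {u} l∈ u∈ = Equivalence.to (⊕-correct x u l)
    (All.lookup (All.++⁻ʳ (frees bs) sol) (∈-cartesianProductWith⁺ _⊕_ u∈ l∈))
  interpolant = interpolate (lowers bs) (uppers bs) (lowerValue x) (upperValue x) gap
  x₀ = proj₁ interpolant
  l = proj₁ (proj₂ interpolant)
  u = proj₂ (proj₂ interpolant)

eliminateAll : ∀ m {k} → List (Row (m ℕ.+ k)) → List (Row k)
eliminateAll zero    S = S
eliminateAll (suc m) S = eliminateAll m (eliminate S)

eliminateAll-sound : ∀ m {k} S (xs : Vec ℚ m) (ys : Vec ℚ k) → Solves S (xs Vec.++ ys) → Solves (eliminateAll m S) ys
eliminateAll-sound zero    S []        ys sol = sol
eliminateAll-sound (suc m) S (x₀ ∷ xs) ys sol =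
  eliminateAll-sound m (eliminate S) xs ys (eliminate-sound S x₀ (xs Vec.++ ys) sol)

eliminateAll-complete : ∀ m {k} S (ys : Vec ℚ k) → Solves (eliminateAll m S) ys → ∃ λ xs → Solves S (xs Vec.++ ys)
eliminateAll-complete zero    S ys sol = [] , sol
eliminateAll-complete (suc m) S ys sol =
  let xs , sol′ = eliminateAll-complete m (eliminate S) ys sol
      x₀ , sol″ = eliminate-complete S (xs Vec.++ ys) sol′
  in x₀ ∷ xs , sol″

minimum-attained₁ : ∀ (T : List (Row 1)) {b t₀} → Solves T [ t₀ ] → (∀ t → Solves T [ t ] → b ≤ t) →
                    ∃ λ d → Solves T [ d ] × (∀ t → Solves T [ t ] → d ≤ t)
minimum-attained₁ T {b} {t₀} sol₀ bounded = d , solution , minimal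
  where
  bs = map asBound T
  holds : ∀ t → Solves T [ t ] → HoldsAll t [] bs
  holds t sol = All-Holds⇒ t [] bs (All.map⁺ (All.map (λ {r} → Equivalence.to (asBound-correct t [] r)) sol))
  d = max b (map (lowerValue []) (lowers bs))
  minimal : ∀ t → Solves T [ t ] → d ≤ t
  minimal t sol = max≤v⁺ (bounded t sol) (All.map⁺ (proj₂ (proj₂ (holds t sol))))
  solution : Solves T [ d ]
  solution =
    let f , u , _ = holds t₀ sol₀
        l = All.map⁻ (xs≤max b (map (lowerValue []) (lowers bs)))
    in All.map (λ {r} → Equivalence.from (asBound-correct d [] r))
         (All.map⁻ (All-Holds⇐ d [] bs (f , All.map (≤-trans (minimal t₀ sol₀)) u , l)))

linear-minimum-attained : ∀ m (S : List (Row (m ℕ.+ 1))) {b xs₀ t₀} → Solves S (xs₀ Vec.++ [ t₀ ]) →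
                          (∀ xs t → Solves S (xs Vec.++ [ t ]) → b ≤ t) →
                          ∃ λ d → (∃ λ xs → Solves S (xs Vec.++ [ d ])) × (∀ xs t → Solves S (xs Vec.++ [ t ]) → d ≤ t)
linear-minimum-attained m S {xs₀ = xs₀} {t₀} sol₀ bounded =
  d , eliminateAll-complete m S [ d ] solution , λ xs t sol → minimal t (eliminateAll-sound m S xs [ t ] sol)
  where
  projected = minimum-attained₁ (eliminateAll m S) (eliminateAll-sound m S xs₀ [ t₀ ] sol₀)
    (λ t sol → let xs , sol′ = eliminateAll-complete m S [ t ] sol in bounded xs t sol′)
  d = proj₁ projected
  solution = proj₁ (proj₂ projected)
  minimal = proj₂ (proj₂ projected)

-- Levels of the Boolean cube

allPoints-complete : ∀ (x : Point n) → x ∈ allPoints n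
allPoints-complete []          = here refl
allPoints-complete (true  ∷ x) = ∈-++⁺ˡ (∈-map⁺ (true ∷_) (allPoints-complete x))
allPoints-complete (false ∷ x) = ∈-++⁺ʳ (map (true ∷_) (allPoints _)) (∈-map⁺ (false ∷_) (allPoints-complete x))

∑-allPoints-suc : ∀ n (g : Point (suc n) → ℚ) →
                  ∑ (allPoints (suc n)) g ≡ ∑ (allPoints n) (g ∘ (true ∷_)) + ∑ (allPoints n) (g ∘ (false ∷_))
∑-allPoints-suc n g = trans (∑-++ (map (true ∷_) (allPoints n)) _ g)
                            (cong₂ _+_ (∑-map (true ∷_) (allPoints n) g) (∑-map (false ∷_) (allPoints n) g))

ones≤n : ∀ (x : Point n) → ones x ℕ.≤ n
ones≤n []          = ℕ.z≤n
ones≤n (true  ∷ x) = ℕ.s≤s (ones≤n x)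
ones≤n (false ∷ x) = ℕ.m≤n⇒m≤1+n (ones≤n x)

weight : Point n → Fin (suc n)
weight x = Fin.fromℕ< (ℕ.s≤s (ones≤n x))

toℕ-weight : ∀ (x : Point n) → toℕ (weight x) ≡ ones x
toℕ-weight x = Fin.toℕ-fromℕ< (ℕ.s≤s (ones≤n x))

weight-cong : ∀ {x y : Point n} → ones x ≡ ones y → weight x ≡ weight y
weight-cong {x = x} {y} eq = Fin.toℕ-injective (trans (toℕ-weight x) (trans eq (sym (toℕ-weight y))))

pointOfWeight : Fin (suc n) → Point n
pointOfWeight {zero}  zero    = []
pointOfWeight {suc n} zero    = false ∷ pointOfWeight zero
pointOfWeight {suc n} (suc k) = true ∷ pointOfWeight k

ones-pointOfWeight : ∀ (k : Fin (suc n)) → ones (pointOfWeight k) ≡ toℕ k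
ones-pointOfWeight {zero}  zero    = refl
ones-pointOfWeight {suc n} zero    = ones-pointOfWeight {n} zero
ones-pointOfWeight {suc n} (suc k) = cong suc (ones-pointOfWeight k)

weight-pointOfWeight : ∀ (k : Fin (suc n)) → weight (pointOfWeight k) ≡ k
weight-pointOfWeight k = Fin.toℕ-injective (trans (toℕ-weight (pointOfWeight k)) (ones-pointOfWeight k))

δ : ℕ → ℕ → ℚ
δ j k = if does (j ℕ.≟ k) then 1ℚ else 0ℚ

δ-refl : ∀ k → δ k k ≡ 1ℚ
δ-refl k = cong (if_then 1ℚ else 0ℚ) (dec-true (k ℕ.≟ k) refl)

δ-≢ : ∀ {j k} → j ≢ k → δ j k ≡ 0ℚ
δ-≢ {j} {k} j≢k = cong (if_then 1ℚ else 0ℚ) (dec-false (j ℕ.≟ k) j≢k)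

δ-sym : ∀ j k → δ j k ≡ δ k j
δ-sym j k with j ℕ.≟ k
... | yes refl = refl
... | no j≢k   = trans (δ-≢ j≢k) (sym (δ-≢ (j≢k ∘ sym)))

δ-nonNeg : ∀ j k → 0ℚ ≤ δ j k
δ-nonNeg j k with j ℕ.≟ k
... | yes refl = subst (0ℚ ≤_) (sym (δ-refl j)) (<⇒≤ (positive⁻¹ 1ℚ))
... | no j≢k   = subst (0ℚ ≤_) (sym (δ-≢ j≢k)) ≤-refl

δ-transfer : ∀ {j k} {p q : ℚ} → (j ≡ k → p ≡ q) → δ j k * p ≡ δ j k * q
δ-transfer {j} {k} {p} {q} p≡q with j ℕ.≟ k
... | yes j≡k = cong (δ j k *_) (p≡q j≡k)
... | no j≢k  = trans (cong (_* p) (δ-≢ j≢k)) (trans (*-zeroˡ p) (sym (trans (cong (_* q) (δ-≢ j≢k)) (*-zeroˡ q))))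

levelSize : Fin (suc n) → ℚ
levelSize {n} k = ∑ (allPoints n) (λ z → δ (ones z) (toℕ k))

levelSize-pos : ∀ (k : Fin (suc n)) → 0ℚ < levelSize k
levelSize-pos {n} k = <-≤-trans (positive⁻¹ 1ℚ)
  (subst (_≤ levelSize k) (trans (cong (λ j → δ j (toℕ k)) (ones-pointOfWeight k)) (δ-refl (toℕ k)))
    (term≤∑ (λ z → δ-nonNeg (ones z) (toℕ k)) (allPoints-complete (pointOfWeight k))))

levelSize⁻¹ : Fin (suc n) → ℚ
levelSize⁻¹ k = proj₁ (reciprocal (levelSize-pos k))

levelSize⁻¹-pos : ∀ (k : Fin (suc n)) → 0ℚ < levelSize⁻¹ k
levelSize⁻¹-pos k = proj₁ (proj₂ (reciprocal (levelSize-pos k)))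

levelSize⁻¹-inverse : ∀ (k : Fin (suc n)) → levelSize⁻¹ k * levelSize k ≡ 1ℚ
levelSize⁻¹-inverse k = proj₂ (proj₂ (reciprocal (levelSize-pos k)))

levelAverage : (Point n → ℚ) → Fin (suc n) → ℚ
levelAverage {n} g k = levelSize⁻¹ k * ∑ (allPoints n) (λ z → δ (ones z) (toℕ k) * g z)

levelAverage-nonNeg : ∀ {m : Point n → ℚ} → (∀ x → 0ℚ ≤ m x) → ∀ k → 0ℚ ≤ levelAverage m k
levelAverage-nonNeg {n} {m} m≥0 k = subst (_≤ levelAverage m k) (*-zeroʳ (levelSize⁻¹ k))
  (*-monoˡ-≤-nonNeg (levelSize⁻¹ k) {{nonNegative (<⇒≤ (levelSize⁻¹-pos k))}}
    (∑-nonNeg (allPoints n) (λ z → subst (_≤ δ (ones z) (toℕ k) * m z) (*-zeroʳ (δ (ones z) (toℕ k)))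
      (*-monoˡ-≤-nonNeg (δ (ones z) (toℕ k)) {{nonNegative (δ-nonNeg (ones z) (toℕ k))}} (m≥0 z)))))

levelAverage-1 : ∀ (k : Fin (suc n)) → levelAverage (λ _ → 1ℚ) k ≡ 1ℚ
levelAverage-1 {n} k = trans (cong (levelSize⁻¹ k *_) (∑-cong (allPoints n) (λ z → *-identityʳ _))) (levelSize⁻¹-inverse k)

levelKernel : Point n → Point n → ℚ
levelKernel x z = levelSize⁻¹ (weight x) * δ (ones x) (ones z)

levelKernel-sym : ∀ (x z : Point n) → levelKernel x z ≡ levelKernel z x
levelKernel-sym x z = begin
  levelSize⁻¹ (weight x) * δ (ones x) (ones z)  ≡⟨ *-comm (levelSize⁻¹ (weight x)) _ ⟩
  δ (ones x) (ones z) * levelSize⁻¹ (weight x)  ≡⟨ δ-transfer (cong levelSize⁻¹ ∘ weight-cong {x = x} {z}) ⟩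
  δ (ones x) (ones z) * levelSize⁻¹ (weight z)  ≡⟨ cong (_* levelSize⁻¹ (weight z)) (δ-sym (ones x) (ones z)) ⟩
  δ (ones z) (ones x) * levelSize⁻¹ (weight z)  ≡⟨ *-comm (δ (ones z) (ones x)) _ ⟩
  levelSize⁻¹ (weight z) * δ (ones z) (ones x)  ∎
  where open ≡-Reasoning

levelAverage-kernel : ∀ (g : Point n → ℚ) x → levelAverage g (weight x) ≡ ∑ (allPoints n) (λ z → levelKernel x z * g z)
levelAverage-kernel {n} g x = trans (sym (∑-*ˡ (allPoints n) (levelSize⁻¹ (weight x)) _)) (∑-cong (allPoints n) entry)
  where
  entry : ∀ z → levelSize⁻¹ (weight x) * (δ (ones z) (toℕ (weight x)) * g z) ≡ levelKernel x z * g z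
  entry z = trans (cong (λ d → levelSize⁻¹ (weight x) * (d * g z))
                        (trans (cong (δ (ones z)) (toℕ-weight x)) (δ-sym (ones z) (ones x))))
                  (sym (*-assoc (levelSize⁻¹ (weight x)) (δ (ones x) (ones z)) (g z)))

levelAverage-selfAdjoint : ∀ (g h : Point n → ℚ) →
  ∑ (allPoints n) (λ x → g x * levelAverage h (weight x)) ≡ ∑ (allPoints n) (λ z → h z * levelAverage g (weight z))
levelAverage-selfAdjoint {n} g h = begin
  ∑ P (λ x → g x * levelAverage h (weight x))
    ≡⟨ ∑-cong P (λ x → trans (cong (g x *_) (levelAverage-kernel h x)) (sym (∑-*ˡ P (g x) _))) ⟩
  ∑ P (λ x → ∑ P (λ z → g x * (levelKernel x z * h z)))
    ≡⟨ ∑-swap P P _ ⟩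
  ∑ P (λ z → ∑ P (λ x → g x * (levelKernel x z * h z)))
    ≡⟨ ∑-cong P (λ z → ∑-cong P (λ x →
         trans (cong (λ k → g x * (k * h z)) (levelKernel-sym x z)) (swap (g x) (levelKernel z x) (h z)))) ⟩
  ∑ P (λ z → ∑ P (λ x → h z * (levelKernel z x * g x)))
    ≡⟨ ∑-cong P (λ z → trans (∑-*ˡ P (h z) _) (cong (h z *_) (sym (levelAverage-kernel g z)))) ⟩
  ∑ P (λ z → h z * levelAverage g (weight z)) ∎
  where
  open ≡-Reasoning
  P = allPoints n
  swap : ∀ a k b → a * (k * b) ≡ b * (k * a)
  swap = solve 3 (λ a k b → a :* (k :* b) := b :* (k :* a)) refl

-- Permutations of the coordinates

∑-allFin-suc : ∀ n (g : Fin (suc n) → ℚ) → ∑ (allFin (suc n)) g ≡ g zero + ∑ (allFin n) (g ∘ suc)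
∑-allFin-suc n g = cong (λ xs → g zero + sumℚ xs) (trans (List.map-tabulate suc g) (sym (List.map-tabulate id (g ∘ suc))))

-- Lehmer code: a permutation of n + 1 coordinates permutes the last n and then inserts the first at position i.
Perm : ℕ → Set
Perm zero    = ⊤
Perm (suc n) = Fin (suc n) × Perm n

permute : Perm n → Vec A n → Vec A n
permute {zero}  _       []      = []
permute {suc n} (i , π) (a ∷ v) = Vec.insertAt (permute π v) i a

unpermute : Perm n → Vec A n → Vec A n
unpermute {zero}  _       []  = []
unpermute {suc n} (i , π) x = Vec.lookup x i ∷ unpermute π (Vec.removeAt x i)

permute-unpermute : ∀ (π : Perm n) (x : Vec A n) → permute π (unpermute π x) ≡ x
permute-unpermute {zero}  _       []  = refl
permute-unpermute {suc n} (i , π) x =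
  trans (cong (λ v → Vec.insertAt v i (Vec.lookup x i)) (permute-unpermute π (Vec.removeAt x i))) (Vec.insertAt-removeAt x i)

allPerms : ∀ n → List (Perm n)
allPerms zero    = tt ∷ []
allPerms (suc n) = cartesianProductWith _,_ (allFin (suc n)) (allPerms n)

∑-cartesianProduct : ∀ (xs : List A) (ys : List B) g →
                     ∑ (cartesianProductWith _,_ xs ys) g ≡ ∑ xs (λ a → ∑ ys (λ b → g (a , b)))
∑-cartesianProduct []       ys g = refl
∑-cartesianProduct (x ∷ xs) ys g =
  trans (∑-++ (map (x ,_) ys) _ g) (cong₂ _+_ (∑-map (x ,_) ys g) (∑-cartesianProduct xs ys g))

ones-∷-cong : ∀ a {u v : Point n} → ones u ≡ ones v → ones (a ∷ u) ≡ ones (a ∷ v)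
ones-∷-cong true  eq = cong suc eq
ones-∷-cong false eq = eq

ones-swap : ∀ a b (w : Point n) → ones (a ∷ b ∷ w) ≡ ones (b ∷ a ∷ w)
ones-swap true  true  w = refl
ones-swap true  false w = refl
ones-swap false true  w = refl
ones-swap false false w = refl

ones-insertAt : ∀ (w : Point n) i a → ones (Vec.insertAt w i a) ≡ ones (a ∷ w)
ones-insertAt w       zero    a = refl
ones-insertAt (b ∷ w) (suc i) a = trans (ones-∷-cong b (ones-insertAt w i a)) (ones-swap b a w)

ones-permute : ∀ (π : Perm n) (x : Point n) → ones (permute π x) ≡ ones x
ones-permute {zero}  _       []      = refl
ones-permute {suc n} (i , π) (a ∷ v) = trans (ones-insertAt (permute π v) i a) (ones-∷-cong a (ones-permute π v))

literal : Bool × Bool → Bool → Bool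
literal (p , q) b = (p ∧ b) ∨ (q ∧ not b)

evalClause-insertAt : ∀ (c : Clause n) (x : Point n) i l b →
                      evalClause (Vec.insertAt c i l) (Vec.insertAt x i b) ≡ literal l b ∨ evalClause c x
evalClause-insertAt c       x       zero    l b = refl
evalClause-insertAt (l₀ ∷ c) (b₀ ∷ x) (suc i) l b =
  trans (cong (literal l₀ b₀ ∨_) (evalClause-insertAt c x i l b)) (∨-swap (literal l₀ b₀) (literal l b) _)
  where
  ∨-swap : ∀ p q r → p ∨ (q ∨ r) ≡ q ∨ (p ∨ r)
  ∨-swap p q r = trans (sym (Bool.∨-assoc p q r)) (trans (cong (_∨ r) (Bool.∨-comm p q)) (Bool.∨-assoc q p r))

evalClause-permute : ∀ (π : Perm n) (c : Clause n) (x : Point n) → evalClause (permute π c) (permute π x) ≡ evalClause c x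
evalClause-permute {zero}  _       []       []      = refl
evalClause-permute {suc n} (i , π) (l ∷ c) (b ∷ x) =
  trans (evalClause-insertAt (permute π c) (permute π x) i l b) (cong (literal l b ∨_) (evalClause-permute π c x))

evalCNF-unpermute : ∀ (π : Perm n) (φ : CNF n) x → evalCNF (map (unpermute π) φ) x ≡ evalCNF φ (permute π x)
evalCNF-unpermute π []      x = refl
evalCNF-unpermute π (c ∷ φ) x = cong₂ _∧_ evalClause-unpermute (evalCNF-unpermute π φ x)
  where
  evalClause-unpermute : evalClause (unpermute π c) x ≡ evalClause c (permute π x)
  evalClause-unpermute = trans (sym (evalClause-permute π (unpermute π c) x))
                               (cong (λ c′ → evalClause c′ (permute π x)) (permute-unpermute π c))

InCNF-unpermute : ∀ {f : Point n → Bool} → SymmetricFn f → ∀ (π : Perm n) {φ} → InCNF f φ → InCNF f (map (unpermute π) φ)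
InCNF-unpermute {f = f} symmetric π {φ} φ⊆f x φπ[x] =
  trans (symmetric x (permute π x) (sym (ones-permute π x))) (φ⊆f (permute π x) (trans (sym (evalCNF-unpermute π φ x)) φπ[x]))

fromℕ : ℕ → ℚ
fromℕ zero    = 0ℚ
fromℕ (suc k) = 1ℚ + fromℕ k

occurrences : Bool → Point n → ℕ
occurrences true  x = ones x
occurrences false x = ones (Vec.map not x)

occurrences-false : ∀ (x : Point n) → occurrences false x ≡ n ℕ.∸ ones x
occurrences-false []          = refl
occurrences-false (true  ∷ x) = occurrences-false x
occurrences-false (false ∷ x) = trans (cong suc (occurrences-false x)) (sym (ℕ.+-∸-assoc 1 (ones≤n x)))

occurrences-cong : ∀ a {x y : Point n} → ones x ≡ ones y → occurrences a x ≡ occurrences a y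
occurrences-cong true  eq = eq
occurrences-cong false {x} {y} eq = trans (occurrences-false x) (trans (cong (_ ℕ.∸_) eq) (sym (occurrences-false y)))

∑-occurrences-suc : ∀ n a (h : Point (suc n) → ℚ) →
  ∑ (allPoints (suc n)) (λ z → fromℕ (occurrences a z) * h z)
    ≡ ∑ (allPoints n) (λ w → h (a ∷ w)) + ∑ (allPoints (suc n)) (λ z → fromℕ (occurrences a (Vec.tail z)) * h z)
∑-occurrences-suc n a h =
  trans (∑-allPoints-suc n _) (trans (regroup a) (cong (∑ P (h ∘ (a ∷_)) +_) (sym (∑-allPoints-suc n _))))
  where
  P = allPoints n
  O : ∀ {m} → Bool → Point m → ℚ
  O a w = fromℕ (occurrences a w)
  S : Bool → Bool → ℚ
  S a b = ∑ P (λ w → O a w * h (b ∷ w))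
  one+ : ∀ a b → ∑ P (λ w → (1ℚ + O a w) * h (b ∷ w)) ≡ ∑ P (h ∘ (b ∷_)) + S a b
  one+ a b = trans (∑-cong P (λ w → trans (*-distribʳ-+ (h (b ∷ w)) 1ℚ (O a w))
                                          (cong (_+ O a w * h (b ∷ w)) (*-identityˡ (h (b ∷ w))))))
                   (∑-+ P (h ∘ (b ∷_)) _)
  regroup : ∀ a → ∑ P (λ w → O a (true ∷ w) * h (true ∷ w)) + ∑ P (λ w → O a (false ∷ w) * h (false ∷ w))
                  ≡ ∑ P (h ∘ (a ∷_)) + (S a true + S a false)
  regroup true  = trans (cong (_+ S true false) (one+ true true)) (+-assoc (∑ P (h ∘ (true ∷_))) _ _)
  regroup false = trans (cong (S false true +_) (one+ false false)) (swap (S false true) (∑ P (h ∘ (false ∷_))) _)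
    where
    swap : ∀ p q r → p + (q + r) ≡ q + (p + r)
    swap = solve 3 (λ p q r → p :+ (q :+ r) := q :+ (p :+ r)) refl

-- Inserting a at every position of every w counts each z once for every coordinate of z equal to a.
∑-insertAt : ∀ n a (h : Point (suc n) → ℚ) →
  ∑ (allPoints n) (λ w → ∑ (allFin (suc n)) (λ i → h (Vec.insertAt w i a)))
    ≡ ∑ (allPoints (suc n)) (λ z → fromℕ (occurrences a z) * h z)
∑-insertAt-suc : ∀ n a (h : Point (suc n) → ℚ) →
  ∑ (allPoints n) (λ w → ∑ (allFin n) (λ i → h (Vec.insertAt w (suc i) a)))
    ≡ ∑ (allPoints (suc n)) (λ z → fromℕ (occurrences a (Vec.tail z)) * h z)

∑-insertAt n a h = begin
  ∑ P (λ w → ∑ (allFin (suc n)) (λ i → h (Vec.insertAt w i a)))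
    ≡⟨ ∑-cong P (λ w → ∑-allFin-suc n (λ i → h (Vec.insertAt w i a))) ⟩
  ∑ P (λ w → h (a ∷ w) + ∑ (allFin n) (λ i → h (Vec.insertAt w (suc i) a)))
    ≡⟨ ∑-+ P _ _ ⟩
  ∑ P (λ w → h (a ∷ w)) + ∑ P (λ w → ∑ (allFin n) (λ i → h (Vec.insertAt w (suc i) a)))
    ≡⟨ cong (∑ P (λ w → h (a ∷ w)) +_) (∑-insertAt-suc n a h) ⟩
  ∑ P (λ w → h (a ∷ w)) + ∑ (allPoints (suc n)) (λ z → fromℕ (occurrences a (Vec.tail z)) * h z)
    ≡⟨ sym (∑-occurrences-suc n a h) ⟩
  ∑ (allPoints (suc n)) (λ z → fromℕ (occurrences a z) * h z) ∎
  where
  open ≡-Reasoning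
  P = allPoints n

∑-insertAt-suc zero    true  h = sym (trans (∑-cong (allPoints 1) (λ z → *-zeroˡ (h z))) (∑-zero (allPoints 1)))
∑-insertAt-suc zero    false h = sym (trans (∑-cong (allPoints 1) (λ z → *-zeroˡ (h z))) (∑-zero (allPoints 1)))
∑-insertAt-suc (suc n) a h = begin
  ∑ (allPoints (suc n)) (λ w → ∑ (allFin (suc n)) (λ i → h (Vec.insertAt w (suc i) a)))
    ≡⟨ ∑-allPoints-suc n _ ⟩
  ∑ P (λ w → ∑ (allFin (suc n)) (λ i → h (true ∷ Vec.insertAt w i a)))
    + ∑ P (λ w → ∑ (allFin (suc n)) (λ i → h (false ∷ Vec.insertAt w i a)))
    ≡⟨ cong₂ _+_ (∑-insertAt n a (h ∘ (true ∷_))) (∑-insertAt n a (h ∘ (false ∷_))) ⟩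
  ∑ (allPoints (suc n)) (λ z → fromℕ (occurrences a z) * h (true ∷ z))
    + ∑ (allPoints (suc n)) (λ z → fromℕ (occurrences a z) * h (false ∷ z))
    ≡⟨ sym (∑-allPoints-suc (suc n) _) ⟩
  ∑ (allPoints (suc (suc n))) (λ z → fromℕ (occurrences a (Vec.tail z)) * h z) ∎
  where
  open ≡-Reasoning
  P = allPoints n

∑-insertAt-level : ∀ n a (v : Point n) (g : Point (suc n) → ℚ) →
  ∑ (allPoints n) (λ w → ∑ (allFin (suc n)) (λ i → δ (ones w) (ones v) * g (Vec.insertAt w i a)))
    ≡ fromℕ (occurrences a (a ∷ v)) * ∑ (allPoints (suc n)) (λ z → δ (ones z) (ones (a ∷ v)) * g z)
∑-insertAt-level n a v g = begin
  ∑ P (λ w → ∑ I (λ i → δ (ones w) (ones v) * g (Vec.insertAt w i a)))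
    ≡⟨ ∑-cong P (λ w → ∑-cong I (λ i → cong (_* g (Vec.insertAt w i a)) (sameLevel w i))) ⟩
  ∑ P (λ w → ∑ I (λ i → H (Vec.insertAt w i a)))
    ≡⟨ ∑-insertAt n a H ⟩
  ∑ Z (λ z → fromℕ (occurrences a z) * H z)
    ≡⟨ ∑-cong Z constantOnLevel ⟩
  ∑ Z (λ z → fromℕ (occurrences a (a ∷ v)) * H z)
    ≡⟨ ∑-*ˡ Z (fromℕ (occurrences a (a ∷ v))) H ⟩
  fromℕ (occurrences a (a ∷ v)) * ∑ Z H ∎
  where
  open ≡-Reasoning
  I = allFin (suc n)
  P = allPoints n
  Z = allPoints (suc n)
  H : Point (suc n) → ℚ
  H z = δ (ones z) (ones (a ∷ v)) * g z
  sameLevel : ∀ w i → δ (ones w) (ones v) ≡ δ (ones (Vec.insertAt w i a)) (ones (a ∷ v))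
  sameLevel w i = trans (δ-∷ a) (cong (λ k → δ k (ones (a ∷ v))) (sym (ones-insertAt w i a)))
    where
    δ-∷ : ∀ a → δ (ones w) (ones v) ≡ δ (ones (a ∷ w)) (ones (a ∷ v))
    δ-∷ true  = refl
    δ-∷ false = refl
  constantOnLevel : ∀ z → fromℕ (occurrences a z) * H z ≡ fromℕ (occurrences a (a ∷ v)) * H z
  constantOnLevel z = trans (commute (fromℕ (occurrences a z)) (δ (ones z) (ones (a ∷ v))) (g z))
    (trans (δ-transfer (λ eq → cong (λ o → fromℕ o * g z) (occurrences-cong a {z} {a ∷ v} eq)))
           (sym (commute (fromℕ (occurrences a (a ∷ v))) (δ (ones z) (ones (a ∷ v))) (g z))))
    where
    commute : ∀ o d x → o * (d * x) ≡ d * (o * x)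
    commute = solve 3 (λ o d x → o :* (d :* x) := d :* (o :* x)) refl

stabiliserSize : Point n → ℚ
stabiliserSize []      = 1ℚ
stabiliserSize (a ∷ v) = stabiliserSize v * fromℕ (occurrences a (a ∷ v))

-- Every point on the level of y is reached from y by exactly stabiliserSize y permutations.
∑-orbit : ∀ n (y : Point n) (g : Point n → ℚ) →
  ∑ (allPerms n) (λ π → g (permute π y)) ≡ stabiliserSize y * ∑ (allPoints n) (λ z → δ (ones z) (ones y) * g z)
∑-orbit zero    []      g = sym (trans (*-identityˡ _) (cong (_+ 0ℚ) (trans (cong (_* g []) (δ-refl 0)) (*-identityˡ (g [])))))
∑-orbit (suc n) (a ∷ v) g = begin
  ∑ (allPerms (suc n)) (λ π → g (permute π (a ∷ v)))
    ≡⟨ ∑-cartesianProduct I (allPerms n) _ ⟩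
  ∑ I (λ i → ∑ (allPerms n) (λ π → g (Vec.insertAt (permute π v) i a)))
    ≡⟨ ∑-cong I (λ i → ∑-orbit n v (λ w → g (Vec.insertAt w i a))) ⟩
  ∑ I (λ i → stabiliserSize v * ∑ P (λ w → δ (ones w) (ones v) * g (Vec.insertAt w i a)))
    ≡⟨ ∑-*ˡ I (stabiliserSize v) _ ⟩
  stabiliserSize v * ∑ I (λ i → ∑ P (λ w → δ (ones w) (ones v) * g (Vec.insertAt w i a)))
    ≡⟨ cong (stabiliserSize v *_) (trans (∑-swap I P _) (∑-insertAt-level n a v g)) ⟩
  stabiliserSize v * (fromℕ (occurrences a (a ∷ v)) * ∑ (allPoints (suc n)) (λ z → δ (ones z) (ones (a ∷ v)) * g z))
    ≡⟨ sym (*-assoc (stabiliserSize v) _ _) ⟩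
  stabiliserSize (a ∷ v) * ∑ (allPoints (suc n)) (λ z → δ (ones z) (ones (a ∷ v)) * g z) ∎
  where
  open ≡-Reasoning
  I = allFin (suc n)
  P = allPoints n

permCount : ℕ → ℚ
permCount n = ∑ (allPerms n) (λ _ → 1ℚ)

somePerm : ∀ n → ∃ λ (π : Perm n) → π ∈ allPerms n
somePerm zero    = tt , here refl
somePerm (suc n) =
  (zero , proj₁ (somePerm n)) , ∈-cartesianProductWith⁺ _,_ {xs = allFin (suc n)} (here refl) (proj₂ (somePerm n))

permCount-pos : ∀ n → 0ℚ < permCount n
permCount-pos n = <-≤-trans (positive⁻¹ 1ℚ) (term≤∑ (λ _ → <⇒≤ (positive⁻¹ 1ℚ)) (proj₂ (somePerm n)))

∑-orbit-average : ∀ (y : Point n) g → ∑ (allPerms n) (λ π → g (permute π y)) ≡ permCount n * levelAverage g (weight y)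
∑-orbit-average {n} y g = begin
  ∑ (allPerms n) (λ π → g (permute π y))
    ≡⟨ ∑-orbit n y g ⟩
  stabiliserSize y * S
    ≡⟨ cong (stabiliserSize y *_) (sym (*-identityˡ S)) ⟩
  stabiliserSize y * (1ℚ * S)
    ≡⟨ cong (λ s → stabiliserSize y * (s * S)) (sym (trans (*-comm (levelSize k) _) (levelSize⁻¹-inverse k))) ⟩
  stabiliserSize y * (levelSize k * levelSize⁻¹ k * S)
    ≡⟨ regroup (stabiliserSize y) (levelSize k) (levelSize⁻¹ k) S ⟩
  stabiliserSize y * levelSize k * (levelSize⁻¹ k * S)
    ≡⟨ cong₂ _*_ (sym (trans (∑-orbit n y (λ _ → 1ℚ)) (cong (stabiliserSize y *_) (∑-cong (allPoints n) sameLevel))))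
                 (cong (levelSize⁻¹ k *_) (∑-cong (allPoints n) (λ z → cong (λ j → δ (ones z) j * g z) (sym (toℕ-weight y))))) ⟩
  permCount n * levelAverage g k ∎
  where
  open ≡-Reasoning
  k = weight y
  S = ∑ (allPoints n) (λ z → δ (ones z) (ones y) * g z)
  regroup : ∀ a b c d → a * (b * c * d) ≡ a * b * (c * d)
  regroup = solve 4 (λ a b c d → a :* (b :* c :* d) := a :* b :* (c :* d)) refl
  sameLevel : ∀ z → δ (ones z) (ones y) * 1ℚ ≡ δ (ones z) (toℕ k)
  sameLevel z = trans (*-identityʳ _) (cong (δ (ones z)) (sym (toℕ-weight y)))

-- Ratios of CNFs and symmetrization

𝟙 : Bool → ℚ
𝟙 true  = 1ℚ
𝟙 false = 0ℚ

if-then-0 : ∀ b p → (if b then p else 0ℚ) ≡ p * 𝟙 b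
if-then-0 true  p = sym (*-identityʳ p)
if-then-0 false p = sym (*-zeroʳ p)

probOf : (Point n → ℚ) → CNF n → ℚ
probOf {n} m φ = ∑ (allPoints n) (λ x → if evalCNF φ x then m x else 0ℚ)

recipSuc : ℕ → ℚ
recipSuc k = ℤ.+ 1 / suc k

ratioOf : (Point n → ℚ) → CNF n → ℚ
ratioOf m []      = 0ℚ
ratioOf m (c ∷ φ) = probOf m (c ∷ φ) * recipSuc (length φ)

ratio≡ratioOf : ∀ {f : Point n → Bool} (μ : Distribution f) φ → ratio μ φ ≡ ratioOf (mass μ) φ
ratio≡ratioOf μ []      = refl
ratio≡ratioOf μ (c ∷ φ) = refl

UpperBound : (Point n → Bool) → (Point n → ℚ) → ℚ → Set
UpperBound {n} f m t = ∀ (φ : CNF n) → InCNF f φ → ratioOf m φ ≤ t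

levelAverages : (Point n → ℚ) → Vec ℚ (suc n)
levelAverages m = Vec.tabulate (levelAverage m)

levelMass : Vec ℚ (suc n) → Point n → ℚ
levelMass q x = Vec.lookup q (weight x)

levelMass-cong : ∀ (q : Vec ℚ (suc n)) x y → ones x ≡ ones y → levelMass q x ≡ levelMass q y
levelMass-cong q x y same = cong (Vec.lookup q) (weight-cong {x = x} {y} same)

levelMass-pointOfWeight : ∀ (q : Vec ℚ (suc n)) k → levelMass q (pointOfWeight k) ≡ Vec.lookup q k
levelMass-pointOfWeight q k = cong (Vec.lookup q) (weight-pointOfWeight k)

symmetrize : (Point n → ℚ) → Point n → ℚ
symmetrize m = levelMass (levelAverages m)

symmetrize-≡ : ∀ (m : Point n → ℚ) x → symmetrize m x ≡ levelAverage m (weight x)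
symmetrize-≡ m x = Vec.lookup∘tabulate (levelAverage m) (weight x)

∑-probOf-unpermute : ∀ (m : Point n → ℚ) φ →
  ∑ (allPerms n) (λ π → probOf m (map (unpermute π) φ)) ≡ permCount n * probOf (symmetrize m) φ
∑-probOf-unpermute {n} m φ = begin
  ∑ (allPerms n) (λ π → probOf m (map (unpermute π) φ))
    ≡⟨ ∑-cong (allPerms n) (λ π → ∑-cong P (λ x →
         trans (cong (if_then m x else 0ℚ) (evalCNF-unpermute π φ x)) (if-then-0 _ (m x)))) ⟩
  ∑ (allPerms n) (λ π → ∑ P (λ x → m x * 𝟙φ (permute π x)))
    ≡⟨ ∑-swap (allPerms n) P _ ⟩
  ∑ P (λ x → ∑ (allPerms n) (λ π → m x * 𝟙φ (permute π x)))
    ≡⟨ ∑-cong P (λ x → trans (∑-*ˡ (allPerms n) (m x) (λ π → 𝟙φ (permute π x))) (cong (m x *_) (∑-orbit-average x 𝟙φ))) ⟩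
  ∑ P (λ x → m x * (permCount n * levelAverage 𝟙φ (weight x)))
    ≡⟨ ∑-cong P (λ x → commute (m x) (permCount n) _) ⟩
  ∑ P (λ x → permCount n * (m x * levelAverage 𝟙φ (weight x)))
    ≡⟨ ∑-*ˡ P (permCount n) _ ⟩
  permCount n * ∑ P (λ x → m x * levelAverage 𝟙φ (weight x))
    ≡⟨ cong (permCount n *_) (levelAverage-selfAdjoint m 𝟙φ) ⟩
  permCount n * ∑ P (λ z → 𝟙φ z * levelAverage m (weight z))
    ≡⟨ cong (permCount n *_) (∑-cong P (λ z →
         trans (*-comm (𝟙φ z) _) (trans (cong (_* 𝟙φ z) (sym (symmetrize-≡ m z))) (sym (if-then-0 (evalCNF φ z) _))))) ⟩
  permCount n * probOf (symmetrize m) φ ∎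
  where
  open ≡-Reasoning
  P = allPoints n
  𝟙φ : Point n → ℚ
  𝟙φ = 𝟙 ∘ evalCNF φ
  commute : ∀ a b c → a * (b * c) ≡ b * (a * c)
  commute = solve 3 (λ a b c → a :* (b :* c) := b :* (a :* c)) refl

symmetrize-upperBound : ∀ {f : Point n → Bool} {m e} → SymmetricFn f → UpperBound f m e → UpperBound f (symmetrize m) e
symmetrize-upperBound             symmetric bound []      φ⊆f = bound [] φ⊆f
symmetrize-upperBound {n} {m = m} {e} symmetric bound (c ∷ φ) φ⊆f =
  *-cancelˡ-≤-pos (permCount n) {{positive (permCount-pos n)}} (subst₂ _≤_ averaged constant (∑-mono-≤ (allPerms n) permuted))
  where
  r = recipSuc (length φ)
  permuted : ∀ π → probOf m (map (unpermute π) (c ∷ φ)) * r ≤ e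
  permuted π = subst (λ k → probOf m (map (unpermute π) (c ∷ φ)) * recipSuc k ≤ e) (List.length-map (unpermute π) φ)
                     (bound (map (unpermute π) (c ∷ φ)) (InCNF-unpermute symmetric π {c ∷ φ} φ⊆f))
  averaged : ∑ (allPerms n) (λ π → probOf m (map (unpermute π) (c ∷ φ)) * r) ≡ permCount n * ratioOf (symmetrize m) (c ∷ φ)
  averaged = trans (∑-*ʳ (allPerms n) _ r) (trans (cong (_* r) (∑-probOf-unpermute m (c ∷ φ))) (*-assoc (permCount n) _ r))
  constant : ∑ (allPerms n) (λ _ → e) ≡ permCount n * e
  constant = trans (∑-cong (allPerms n) (λ _ → sym (*-identityˡ e))) (∑-*ʳ (allPerms n) (λ _ → 1ℚ) e)

record IsDistribution (f : Point n → Bool) (m : Point n → ℚ) : Set where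
  field
    m≥0         : ∀ x → 0ℚ ≤ m x
    ∑m≡1        : ∑ (allPoints n) m ≡ 1ℚ
    m-supported : ∀ x → f x ≡ false → m x ≡ 0ℚ

toDistribution : ∀ {f : Point n → Bool} {m} → IsDistribution f m → Distribution f
toDistribution {m = m} m-dist = record { mass = m ; nonneg = m≥0 ; total = ∑m≡1 ; supported = m-supported }
  where open IsDistribution m-dist

isDistribution : ∀ {f : Point n → Bool} (μ : Distribution f) → IsDistribution f (mass μ)
isDistribution μ = record { m≥0 = nonneg μ ; ∑m≡1 = total μ ; m-supported = supported μ }

IsDμ⇒UpperBound : ∀ {f : Point n → Bool} {μ : Distribution f} {e} → IsDμ μ e → UpperBound f (mass μ) e
IsDμ⇒UpperBound {μ = μ} {e} (_ , ratio≤e) φ φ⊆f = subst (_≤ e) (ratio≡ratioOf μ φ) (ratio≤e φ φ⊆f)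

IsDμ-intro : ∀ {f : Point n → Bool} (μ : Distribution f) {d} φ → InCNF f φ → ratioOf (mass μ) φ ≡ d →
             UpperBound f (mass μ) d → IsDμ μ d
IsDμ-intro μ {d} φ φ⊆f ratio≡d bound =
  (φ , φ⊆f , trans (ratio≡ratioOf μ φ) ratio≡d) , λ ψ ψ⊆f → subst (_≤ d) (sym (ratio≡ratioOf μ ψ)) (bound ψ ψ⊆f)

symmetrize-isDistribution : ∀ {f : Point n → Bool} {m} → SymmetricFn f → IsDistribution f m → IsDistribution f (symmetrize m)
symmetrize-isDistribution {n} {f} {m} symmetric m-dist = record
  { m≥0         = λ x → subst (0ℚ ≤_) (sym (symmetrize-≡ m x)) (levelAverage-nonNeg m≥0 (weight x))
  ; ∑m≡1        = begin
      ∑ P (symmetrize m)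
        ≡⟨ ∑-cong P (λ x → trans (symmetrize-≡ m x) (sym (*-identityˡ _))) ⟩
      ∑ P (λ x → 1ℚ * levelAverage m (weight x))
        ≡⟨ levelAverage-selfAdjoint (λ _ → 1ℚ) m ⟩
      ∑ P (λ z → m z * levelAverage (λ _ → 1ℚ) (weight z))
        ≡⟨ ∑-cong P (λ z → trans (cong (m z *_) (levelAverage-1 (weight z))) (*-identityʳ (m z))) ⟩
      ∑ P m
        ≡⟨ ∑m≡1 ⟩
      1ℚ ∎
  ; m-supported = λ x fx≡false → trans (symmetrize-≡ m x)
      (trans (cong (levelSize⁻¹ (weight x) *_) (trans (∑-cong P (vanishes x fx≡false)) (∑-zero P)))
             (*-zeroʳ (levelSize⁻¹ (weight x))))
  }
  where
  open ≡-Reasoning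
  open IsDistribution m-dist
  P = allPoints n
  vanishes : ∀ x → f x ≡ false → ∀ z → δ (ones z) (toℕ (weight x)) * m z ≡ 0ℚ
  vanishes x fx≡false z = trans (δ-transfer (λ eq → m-supported z (trans (symmetric z x (trans eq (toℕ-weight x))) fx≡false)))
                                (*-zeroʳ (δ (ones z) (toℕ (weight x))))

uniformOnLevel : Fin (suc n) → Point n → ℚ
uniformOnLevel k z = δ (ones z) (toℕ k) * levelSize⁻¹ k

uniformOnLevel-isDistribution : ∀ {f : Point n → Bool} → SymmetricFn f → ∀ {x} → f x ≡ true →
                                IsDistribution f (uniformOnLevel (weight x))
uniformOnLevel-isDistribution {n} {f} symmetric {x} fx≡true = record
  { m≥0         = λ z → subst (_≤ uniformOnLevel k z) (*-zeroˡ (levelSize⁻¹ k))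
                    (*-monoʳ-≤-nonNeg (levelSize⁻¹ k) {{nonNegative (<⇒≤ (levelSize⁻¹-pos k))}} (δ-nonNeg (ones z) (toℕ k)))
  ; ∑m≡1        = trans (∑-*ʳ (allPoints n) (λ z → δ (ones z) (toℕ k)) (levelSize⁻¹ k))
                        (trans (*-comm (levelSize k) _) (levelSize⁻¹-inverse k))
  ; m-supported = λ z fz≡false → trans (cong (_* levelSize⁻¹ k) (δ-≢ (other-level z fz≡false))) (*-zeroˡ (levelSize⁻¹ k))
  }
  where
  k = weight x
  other-level : ∀ z → f z ≡ false → ones z ≢ toℕ k
  other-level z fz≡false same with () ← trans (sym fz≡false) (trans (symmetric z x (trans same (toℕ-weight x))) fx≡true)

-- Finitely many CNFs suffice

recipSuc-nonNeg : ∀ k → 0ℚ ≤ recipSuc k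
recipSuc-nonNeg k = nonNegative⁻¹ _ {{normalize-nonNeg 1 (suc k)}}

-- recipSuc k is definitionally fromℚᵘ (mkℚᵘ 1 k), so the comparison can be done in ℚᵘ.
recipSuc-antitone : ∀ {j k} → j ℕ.≤ k → recipSuc k ≤ recipSuc j
recipSuc-antitone {j} {k} j≤k = toℚᵘ-cancel-≤
  (ℚᵘ.≤-respʳ-≃ (ℚᵘ.≃-sym (toℚᵘ-fromℚᵘ (ℚᵘ.mkℚᵘ (ℤ.+ 1) j)))
    (ℚᵘ.≤-respˡ-≃ (ℚᵘ.≃-sym (toℚᵘ-fromℚᵘ (ℚᵘ.mkℚᵘ (ℤ.+ 1) k)))
      (ℚᵘ.*≤* (subst₂ ℤ._≤_ (sym (ℤ.*-identityˡ _)) (sym (ℤ.*-identityˡ _)) (ℤ.+≤+ (ℕ.s≤s j≤k))))))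

probOf-nonNeg : ∀ {m : Point n → ℚ} → (∀ x → 0ℚ ≤ m x) → ∀ φ → 0ℚ ≤ probOf m φ
probOf-nonNeg {n} {m} m≥0 φ = ∑-nonNeg (allPoints n) term
  where
  term : ∀ x → 0ℚ ≤ (if evalCNF φ x then m x else 0ℚ)
  term x with evalCNF φ x
  ... | true  = m≥0 x
  ... | false = ≤-refl

evalCNF-true : ∀ (φ : CNF n) x → evalCNF φ x ≡ true ⇔ All (λ c → evalClause c x ≡ true) φ
evalCNF-true φ x = mk⇔ (to φ) (from φ)
  where
  to : ∀ φ → evalCNF φ x ≡ true → All (λ c → evalClause c x ≡ true) φ
  to []      _  = []
  to (c ∷ φ) eq = Bool.∧-conicalˡ _ _ eq ∷ to φ (Bool.∧-conicalʳ (evalClause c x) _ eq)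
  from : ∀ φ → All (λ c → evalClause c x ≡ true) φ → evalCNF φ x ≡ true
  from []      []       = refl
  from (c ∷ φ) (h ∷ hs) = cong₂ _∧_ h (from φ hs)

evalCNF-sameClauses : ∀ {φ ψ : CNF n} → (∀ {c} → c ∈ φ → c ∈ ψ) → (∀ {c} → c ∈ ψ → c ∈ φ) →
                      ∀ x → evalCNF φ x ≡ evalCNF ψ x
evalCNF-sameClauses {φ = φ} {ψ} φ⊆ψ ψ⊆φ x = ≡true-ext (transfer φ ψ ψ⊆φ) (transfer ψ φ φ⊆ψ)
  where
  transfer : ∀ φ ψ → (∀ {c} → c ∈ ψ → c ∈ φ) → evalCNF φ x ≡ true → evalCNF ψ x ≡ true
  transfer φ ψ ψ⊆φ φ[x] =
    Equivalence.from (evalCNF-true ψ x) (All.tabulate (All.lookup (Equivalence.to (evalCNF-true φ x) φ[x]) ∘ ψ⊆φ))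
  ≡true-ext : ∀ {a b} → (a ≡ true → b ≡ true) → (b ≡ true → a ≡ true) → a ≡ b
  ≡true-ext {true}  {true}  _   _   = refl
  ≡true-ext {true}  {false} a⇒b _   = sym (a⇒b refl)
  ≡true-ext {false} {true}  _   b⇒a = b⇒a refl
  ≡true-ext {false} {false} _   _   = refl

allVecs : List A → ∀ n → List (Vec A n)
allVecs xs zero    = [] ∷ []
allVecs xs (suc n) = cartesianProductWith _∷_ xs (allVecs xs n)

allVecs-complete : ∀ {xs : List A} → (∀ a → a ∈ xs) → ∀ (v : Vec A n) → v ∈ allVecs xs n
allVecs-complete all∈ []      = here refl
allVecs-complete all∈ (a ∷ v) = ∈-cartesianProductWith⁺ _∷_ (all∈ a) (allVecs-complete all∈ v)

allLiterals : List (Bool × Bool)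
allLiterals = cartesianProductWith _,_ (true ∷ false ∷ []) (true ∷ false ∷ [])

allLiterals-complete : ∀ l → l ∈ allLiterals
allLiterals-complete (p , q) = ∈-cartesianProductWith⁺ _,_ (bool∈ p) (bool∈ q)
  where
  bool∈ : ∀ b → b ∈ true ∷ false ∷ []
  bool∈ true  = here refl
  bool∈ false = there (here refl)

allClauses : ∀ n → List (Clause n)
allClauses = allVecs allLiterals

listsUpTo : ℕ → List A → List (List A)
listsUpTo zero    xs = [] ∷ []
listsUpTo (suc k) xs = [] ∷ cartesianProductWith _∷_ xs (listsUpTo k xs)

listsUpTo-complete : ∀ {xs ys : List A} k → (∀ {y} → y ∈ ys → y ∈ xs) → length ys ℕ.≤ k → ys ∈ listsUpTo k xs
listsUpTo-complete {ys = []}     zero    _     _             = here refl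
listsUpTo-complete {ys = []}     (suc k) _     _             = here refl
listsUpTo-complete {ys = y ∷ ys} (suc k) ys⊆xs (ℕ.s≤s |ys|≤k) =
  there (∈-cartesianProductWith⁺ _∷_ (ys⊆xs (here refl)) (listsUpTo-complete k (ys⊆xs ∘ there) |ys|≤k))

∈-─ : ∀ {xs : List A} {y z} (y∈xs : y ∈ xs) → z ∈ xs → z ≢ y → z ∈ (xs Any.─ y∈xs)
∈-─ (here refl)  (here refl)  z≢y = ⊥-elim (z≢y refl)
∈-─ (here refl)  (there z∈xs) _   = z∈xs
∈-─ (there y∈xs) (here refl)  _   = here refl
∈-─ (there y∈xs) (there z∈xs) z≢y = there (∈-─ y∈xs z∈xs z≢y)

Unique-length≤ : ∀ {ys xs : List A} → Unique ys → (∀ {y} → y ∈ ys → y ∈ xs) → length ys ℕ.≤ length xs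
Unique-length≤ {ys = []}     _                _     = ℕ.z≤n
Unique-length≤ {ys = y ∷ ys} {xs} (y∉ys ∷ unique) ys⊆xs =
  subst (suc (length ys) ℕ.≤_) (sym (List.length-removeAt′ xs (Any.index y∈xs)))
    (ℕ.s≤s (Unique-length≤ unique (λ z∈ys → ∈-─ y∈xs (ys⊆xs (there z∈ys)) (All.lookup y∉ys z∈ys ∘ sym))))
  where y∈xs = ys⊆xs (here refl)

InCNF? : ∀ (f : Point n → Bool) φ → Dec (InCNF f φ)
InCNF? {n} f φ = map′ (λ h x → All.lookup h (allPoints-complete x)) (λ h → All.tabulate (λ {x} _ → h x))
  (All.all? (λ x → (evalCNF φ x Bool.≟ true) →-dec (f x Bool.≟ true)) (allPoints n))

CNFs : (Point n → Bool) → List (CNF n)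
CNFs {n} f = filter (InCNF? f) (listsUpTo (length (allClauses n)) (allClauses n))

CNFs-sound : ∀ {f : Point n → Bool} {φ} → φ ∈ CNFs f → InCNF f φ
CNFs-sound {n} {f} φ∈ = proj₂ (∈-filter⁻ (InCNF? f) {xs = listsUpTo (length (allClauses n)) (allClauses n)} φ∈)

CNFs-complete : ∀ {f : Point n → Bool} {φ} → InCNF f φ → Unique φ → φ ∈ CNFs f
CNFs-complete {n} {f} {φ} φ⊆f unique = ∈-filter⁺ (InCNF? f) (listsUpTo-complete _ (λ _ → allClauses-complete _) |φ|≤) φ⊆f
  where
  allClauses-complete = allVecs-complete allLiterals-complete
  |φ|≤ = Unique-length≤ unique (λ _ → allClauses-complete _)

_≟ᶜ_ : ∀ (c d : Clause n) → Dec (c ≡ d)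
_≟ᶜ_ = Vec.≡-dec (Product.≡-dec Bool._≟_ Bool._≟_)

CNFs-cover : ∀ {f : Point n → Bool} {m} → (∀ x → 0ℚ ≤ m x) → ∀ φ → InCNF f φ →
             ∃ λ ψ → ψ ∈ CNFs f × ratioOf m φ ≤ ratioOf m ψ
CNFs-cover m≥0 []      φ⊆f = [] , CNFs-complete φ⊆f [] , ≤-refl
CNFs-cover {n} {f} {m} m≥0 (c ∷ φ) φ⊆f = ψ , CNFs-complete ψ⊆f (deduplicate-! _≟ᶜ_ (c ∷ φ)) , ratio≤
  where
  ψ = deduplicate _≟ᶜ_ (c ∷ φ)
  same : ∀ x → evalCNF (c ∷ φ) x ≡ evalCNF ψ x
  same = evalCNF-sameClauses (∈-deduplicate⁺ _≟ᶜ_) (∈-deduplicate⁻ _≟ᶜ_ (c ∷ φ))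
  ψ⊆f : InCNF f ψ
  ψ⊆f x ψ[x] = φ⊆f x (trans (same x) ψ[x])
  ratio≤ : ratioOf m (c ∷ φ) ≤ ratioOf m ψ
  ratio≤ = subst (λ p → ratioOf m (c ∷ φ) ≤ p * recipSuc (length ψ ℕ.∸ 1))
    (∑-cong (allPoints n) (λ x → cong (if_then m x else 0ℚ) (same x)))
    (*-monoˡ-≤-nonNeg (probOf m (c ∷ φ)) {{nonNegative (probOf-nonNeg m≥0 (c ∷ φ))}}
      (recipSuc-antitone (ℕ.≤-pred (List.length-deduplicate _≟ᶜ_ (c ∷ φ)))))

⊥CNF : CNF n
⊥CNF {n} = Vec.replicate n (false , false) ∷ []

⊥CNF-false : ∀ (x : Point n) → evalCNF ⊥CNF x ≡ false
⊥CNF-false x = cong (_∧ true) (empty-clause x)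
  where
  empty-clause : ∀ {n} (x : Point n) → evalClause (Vec.replicate n (false , false)) x ≡ false
  empty-clause []      = refl
  empty-clause (_ ∷ x) = empty-clause x

⊥CNF-inCNF : ∀ (f : Point n → Bool) → InCNF f ⊥CNF
⊥CNF-inCNF f x ⊥[x] with () ← trans (sym (⊥CNF-false x)) ⊥[x]

⊥CNF-ratio : ∀ (m : Point n → ℚ) → ratioOf m ⊥CNF ≡ 0ℚ
⊥CNF-ratio {n} m =
  trans (cong (_* recipSuc 0) (trans (∑-cong (allPoints n) vanish) (∑-zero (allPoints n)))) (*-zeroˡ (recipSuc 0))
  where
  vanish : ∀ x → (if evalCNF ⊥CNF x then m x else 0ℚ) ≡ 0ℚ
  vanish x = cong (if_then m x else 0ℚ) (⊥CNF-false x)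

UpperBound-nonNeg : ∀ {f : Point n → Bool} {m t} → UpperBound f m t → 0ℚ ≤ t
UpperBound-nonNeg {f = f} {m} bound = subst (_≤ _) (⊥CNF-ratio m) (bound ⊥CNF (⊥CNF-inCNF f))

bestCNF : (Point n → Bool) → (Point n → ℚ) → CNF n
bestCNF f m = argmax (ratioOf m) ⊥CNF (CNFs f)

bestCNF-inCNF : ∀ (f : Point n → Bool) m → InCNF f (bestCNF f m)
bestCNF-inCNF f m = argmax-all (ratioOf m) (⊥CNF-inCNF f) (All.tabulate CNFs-sound)

bestCNF-upperBound : ∀ {f : Point n → Bool} {m} → (∀ x → 0ℚ ≤ m x) → UpperBound f m (ratioOf m (bestCNF f m))
bestCNF-upperBound {f = f} {m} m≥0 φ φ⊆f =
  let ψ , ψ∈ , φ≤ψ = CNFs-cover m≥0 φ φ⊆f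
  in ≤-trans φ≤ψ (All.lookup (f[xs]≤f[argmax] {f = ratioOf m} ⊥CNF (CNFs f)) ψ∈)

-- The linear program over symmetric distributions

-- The variables are a level vector q, giving mass q k to every point of weight k, followed by the bound t.
module LevelProgram {n : ℕ} (f : Point n → Bool) (symmetric : SymmetricFn f) where

  record Feasible (q : Vec ℚ (suc n)) (t : ℚ) : Set where
    constructor _,_
    field
      distribution : IsDistribution f (levelMass q)
      bound        : UpperBound f (levelMass q) t

  infix 4 ⟨_,_⟩≤_
  ⟨_,_⟩≤_ : Vec ℚ (suc n) → ℚ → ℚ → Row (suc n ℕ.+ 1)
  ⟨ a , c ⟩≤ b = a Vec.++ [ c ] , b

  ⟨⟩≤-correct : ∀ a c b q t → Satisfies (q Vec.++ [ t ]) (⟨ a , c ⟩≤ b) ⇔ (a · q + c * t ≤ b)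
  ⟨⟩≤-correct a c b q t = ≤-resp₂-⇔ (trans (·-++ a q [ c ] [ t ]) (cong (a · q +_) (+-identityʳ (c * t)))) refl

  ⟨,0⟩≤-correct : ∀ a b q t → Satisfies (q Vec.++ [ t ]) (⟨ a , 0ℚ ⟩≤ b) ⇔ (a · q ≤ b)
  ⟨,0⟩≤-correct a b q t = ≤-resp₂-⇔ (trans (cong (a · q +_) (*-zeroˡ t)) (+-identityʳ _)) refl ⇔-∘ ⟨⟩≤-correct a 0ℚ b q t

  ⟨-,0⟩≤-correct : ∀ a b q t → Satisfies (q Vec.++ [ t ]) (⟨ Vec.map (- 1ℚ *_) a , 0ℚ ⟩≤ - b) ⇔ (b ≤ a · q)
  ⟨-,0⟩≤-correct a b q t =
    ≤-resp₂-⇔ (cancel b (a · q)) (cancel′ b (a · q))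
      ⇔-∘ (≤-translate (b + a · q) ⇔-∘ (≤-resp₂-⇔ (·-map-* (- 1ℚ) a q) refl ⇔-∘ ⟨,0⟩≤-correct (Vec.map (- 1ℚ *_) a) (- b) q t))
    where
    cancel : ∀ b X → - 1ℚ * X + (b + X) ≡ b
    cancel = solve 2 (λ b X → :- con 1ℚ :* X :+ (b :+ X) := b) refl
    cancel′ : ∀ b X → - b + (b + X) ≡ X
    cancel′ = solve 2 (λ b X → :- b :+ (b :+ X) := X) refl

  ⟨,-1⟩≤-correct : ∀ a q t → Satisfies (q Vec.++ [ t ]) (⟨ a , - 1ℚ ⟩≤ 0ℚ) ⇔ (a · q ≤ t)
  ⟨,-1⟩≤-correct a q t = ≤-resp₂-⇔ (cancel (a · q) t) (+-identityˡ t) ⇔-∘ (≤-translate t ⇔-∘ ⟨⟩≤-correct a (- 1ℚ) 0ℚ q t)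
    where
    cancel : ∀ X t → X + - 1ℚ * t + t ≡ X
    cancel = solve 2 (λ X t → X :+ :- con 1ℚ :* t :+ t := X) refl

  totalVector : Vec ℚ (suc n)
  totalVector = ∑ᵥ (allPoints n) (unit ∘ weight)

  ·-totalVector : ∀ q → totalVector · q ≡ ∑ (allPoints n) (levelMass q)
  ·-totalVector q = trans (·-∑ᵥ (allPoints n) (unit ∘ weight) q) (∑-cong (allPoints n) (λ x → ·-unit (weight x) q))

  ratioVector : CNF n → Vec ℚ (suc n)
  ratioVector []      = zeros (suc n)
  ratioVector (c ∷ φ) =
    Vec.map (recipSuc (length φ) *_) (∑ᵥ (allPoints n) (λ x → if evalCNF (c ∷ φ) x then unit (weight x) else zeros (suc n)))

  ·-ratioVector : ∀ φ q → ratioVector φ · q ≡ ratioOf (levelMass q) φ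
  ·-ratioVector []      q = ·-zeros q
  ·-ratioVector (c ∷ φ) q = trans (·-map-* r V q) (trans (cong (r *_) probability) (*-comm r _))
    where
    r = recipSuc (length φ)
    V = ∑ᵥ (allPoints n) (λ x → if evalCNF (c ∷ φ) x then unit (weight x) else zeros (suc n))
    probability : V · q ≡ probOf (levelMass q) (c ∷ φ)
    probability = trans (·-∑ᵥ (allPoints n) _ q) (∑-cong (allPoints n) (λ x →
      trans (·-if (evalCNF (c ∷ φ) x) (unit (weight x)) q) (cong (if evalCNF (c ∷ φ) x then_else 0ℚ) (·-unit (weight x) q))))

  bad? : ∀ (k : Fin (suc n)) → Dec (f (pointOfWeight k) ≡ false)
  bad? k = f (pointOfWeight k) Bool.≟ false

  badLevels : List (Fin (suc n))
  badLevels = filter bad? (allFin (suc n))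

  nonNegRow badRow : Fin (suc n) → Row (suc n ℕ.+ 1)
  nonNegRow k = ⟨ Vec.map (- 1ℚ *_) (unit k) , 0ℚ ⟩≤ - 0ℚ
  badRow    k = ⟨ unit k , 0ℚ ⟩≤ 0ℚ

  boundRow : CNF n → Row (suc n ℕ.+ 1)
  boundRow φ = ⟨ ratioVector φ , - 1ℚ ⟩≤ 0ℚ

  nonNegRows totalRows badRows boundRows constraints : List (Row (suc n ℕ.+ 1))
  nonNegRows  = map nonNegRow (allFin (suc n))
  totalRows   = (⟨ totalVector , 0ℚ ⟩≤ 1ℚ) ∷ (⟨ Vec.map (- 1ℚ *_) totalVector , 0ℚ ⟩≤ - 1ℚ) ∷ []
  badRows     = map badRow badLevels
  boundRows   = map boundRow (CNFs f)
  constraints = nonNegRows ++ totalRows ++ badRows ++ boundRows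

  feasible⇒solves : ∀ {q t} → Feasible q t → Solves constraints (q Vec.++ [ t ])
  feasible⇒solves {q} {t} (distribution , bound) = All.++⁺ atNonNeg (All.++⁺ atTotal (All.++⁺ atBad atBound))
    where
    open IsDistribution distribution
    open Equivalence
    x = q Vec.++ [ t ]
    atNonNeg : Solves nonNegRows x
    atNonNeg = from Solves-map nonNeg-at
      where
      nonNeg-at : ∀ {k} → k ∈ allFin (suc n) → Satisfies x (nonNegRow k)
      nonNeg-at {k} _ = from (⟨-,0⟩≤-correct (unit k) 0ℚ q t)
        (subst (0ℚ ≤_) (trans (levelMass-pointOfWeight q k) (sym (·-unit k q))) (m≥0 (pointOfWeight k)))
    atTotal : Solves totalRows x
    atTotal = from (⟨,0⟩≤-correct totalVector 1ℚ q t) (≤-reflexive (trans (·-totalVector q) ∑m≡1))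
          ∷ from (⟨-,0⟩≤-correct totalVector 1ℚ q t) (≤-reflexive (sym (trans (·-totalVector q) ∑m≡1))) ∷ []
    atBad : Solves badRows x
    atBad = from (Solves-map {r = badRow}) (λ {k} k∈ → from (⟨,0⟩≤-correct (unit k) 0ℚ q t) (≤-reflexive
      (trans (·-unit k q) (trans (sym (levelMass-pointOfWeight q k))
        (m-supported (pointOfWeight k) (proj₂ (∈-filter⁻ bad? {xs = allFin (suc n)} k∈)))))))
    atBound : Solves boundRows x
    atBound = from (Solves-map {r = boundRow}) (λ {φ} φ∈ → from (⟨,-1⟩≤-correct (ratioVector φ) q t)
      (subst (_≤ t) (sym (·-ratioVector φ q)) (bound φ (CNFs-sound φ∈))))

  solves⇒feasible : ∀ {q t} → Solves constraints (q Vec.++ [ t ]) → Feasible q t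
  solves⇒feasible {q} {t} solution = distribution , bound
    where
    open Equivalence
    atNonNeg = All.++⁻ˡ nonNegRows solution
    atTotal = All.++⁻ˡ totalRows (All.++⁻ʳ nonNegRows solution)
    atBad = All.++⁻ˡ badRows (All.++⁻ʳ totalRows (All.++⁻ʳ nonNegRows solution))
    atBound = All.++⁻ʳ badRows (All.++⁻ʳ totalRows (All.++⁻ʳ nonNegRows solution))
    m≥0 : ∀ x → 0ℚ ≤ levelMass q x
    m≥0 x = subst (0ℚ ≤_) (·-unit (weight x) q)
      (to (⟨-,0⟩≤-correct (unit (weight x)) 0ℚ q t) (to Solves-map atNonNeg (∈-allFin (weight x))))
    bad-weight : ∀ x → f x ≡ false → weight x ∈ badLevels
    bad-weight x fx≡false = ∈-filter⁺ bad? (∈-allFin (weight x))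
      (trans (symmetric (pointOfWeight (weight x)) x (trans (ones-pointOfWeight (weight x)) (toℕ-weight x))) fx≡false)
    distribution : IsDistribution f (levelMass q)
    distribution = record
      { m≥0         = m≥0
      ; ∑m≡1        = ≤-antisym (subst (_≤ 1ℚ) (·-totalVector q) (to (⟨,0⟩≤-correct totalVector 1ℚ q t) (All.head atTotal)))
                                (subst (1ℚ ≤_) (·-totalVector q) (to (⟨-,0⟩≤-correct totalVector 1ℚ q t) (All.head (All.tail atTotal))))
      ; m-supported = λ x fx≡false → ≤-antisym
          (subst (_≤ 0ℚ) (·-unit (weight x) q)
            (to (⟨,0⟩≤-correct (unit (weight x)) 0ℚ q t) (to Solves-map atBad (bad-weight x fx≡false))))
          (m≥0 x)
      }
    bound : UpperBound f (levelMass q) t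
    bound φ φ⊆f = let ψ , ψ∈ , φ≤ψ = CNFs-cover m≥0 φ φ⊆f in
      ≤-trans φ≤ψ (subst (_≤ t) (·-ratioVector ψ q) (to (⟨,-1⟩≤-correct (ratioVector ψ) q t) (to Solves-map atBound ψ∈)))

  optimum : ∀ {x} → f x ≡ true → ∃ λ d → ∃ λ q → Feasible q d × (∀ {q′ t} → Feasible q′ t → d ≤ t)
  optimum {x} fx≡true =
    let d , (q , solution) , minimal =
          linear-minimum-attained (suc n) constraints {xs₀ = q₀} (feasible⇒solves feasible₀) lowerBound
    in d , q , solves⇒feasible solution , λ {q′} {t} feasible → minimal q′ t (feasible⇒solves feasible)
    where
    q₀ = levelAverages (uniformOnLevel (weight x))
    distribution₀ : IsDistribution f (levelMass q₀)
    distribution₀ = symmetrize-isDistribution symmetric (uniformOnLevel-isDistribution symmetric fx≡true)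
    feasible₀ : Feasible q₀ (ratioOf (levelMass q₀) (bestCNF f (levelMass q₀)))
    feasible₀ = distribution₀ , bestCNF-upperBound (IsDistribution.m≥0 distribution₀)
    lowerBound : ∀ q t → Solves constraints (q Vec.++ [ t ]) → 0ℚ ≤ t
    lowerBound q t solution = UpperBound-nonNeg (Feasible.bound (solves⇒feasible solution))

  IsDμ-optimum : ∀ {q d} (feasible : Feasible q d) → (∀ {q′ t} → Feasible q′ t → d ≤ t) →
                 IsDμ (toDistribution (Feasible.distribution feasible)) d
  IsDμ-optimum {q} {d} (distribution , bound) minimal = IsDμ-intro _ φ* φ*∈CNF_f
    (≤-antisym (bound φ* φ*∈CNF_f) (minimal {q} (distribution , bestCNF-upperBound (IsDistribution.m≥0 distribution)))) bound
    where
    φ* = bestCNF f (levelMass q)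
    φ*∈CNF_f = bestCNF-inCNF f (levelMass q)

  symmetrize-feasible : ∀ (ν : Distribution f) {e} → IsDμ ν e → Feasible (levelAverages (mass ν)) e
  symmetrize-feasible ν Dν≡e =
    symmetrize-isDistribution symmetric (isDistribution ν) , symmetrize-upperBound symmetric (IsDμ⇒UpperBound Dν≡e)

corollary3p2 : (n : ℕ) (f : Point n → Bool) → SymmetricFn f →
    (∃ λ (x : Point n) → f x ≡ true) →
    Σ (Distribution f) λ μ → SymmetricDist μ × Σ ℚ λ d → IsDμ μ d ×
    (∀ (ν : Distribution f) (e : ℚ) → IsDμ ν e → d ≤ e)
corollary3p2 n f symmetric (x , fx≡true) =
  let d , q , feasible , minimal = optimum fx≡true
  in toDistribution (Feasible.distribution feasible) , levelMass-cong q , d , IsDμ-optimum feasible minimal ,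
     λ ν e Dν≡e → minimal (symmetrize-feasible ν Dν≡e)
  where open LevelProgram f symmetric
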